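{- For every $n\geq 1$ and every $q\geq 2$, there exists a $q$-eigenfunction $f$ of $H(n,q)$ such that $\mathrm{SND}(f)=2$.
   Context: The Hamming graph $H(n,q)$ has vertex set $\mathbb{Z}_q^n$, two vertices being adjacent iff they differ in exactly one coordinate. For a graph $G$ with vertex set $V$ and real $\lambda$, a $\lambda$-eigenfunction of $G$ is a function $f:V\to\mathbb{R}$, $f\not\equiv 0$, with $\lambda f(x)=\sum_{y\in N(x)}(f(x)-f(y))$ for all $x\in V$, $N(x)$ being the neighbourhood of $x$. A positive (negative) strong nodal domain of $f$ is a maximal connected induced subgraph of $G$ on vertices $x$ with $f(x)>0$ ($f(x)<0$); $\mathrm{SND}(f)$ is the total number of strong nodal domains of $f$. -}

module Defs where

open import Data.Nat using (ℕ; zero; suc)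
open import Data.Fin using (Fin; _≟_)
open import Data.Vec using (Vec; []; _∷_)
open import Data.List using (List; []; _∷_; map; concatMap; filter; foldr)
open import Data.List using () renaming ([_] to [_]ₗ)
open import Data.List.Base using (allFin)
open import Data.Integer using (+_)
open import Data.Rational using (ℚ; 0ℚ; _+_; _-_; _*_; _<_; _/_)
open import Data.Product using (Σ; ∃; _×_; _,_)
open import Relation.Binary.PropositionalEquality using (_≡_; _≢_)
open import Relation.Nullary using (¬_; yes; no)
import Data.Nat as ℕ

V : ℕ → ℕ → Set
V n q = Vec (Fin q) n

dist : ∀ {n q} → V n q → V n q → ℕ
dist [] [] = 0
dist (a ∷ x) (b ∷ y) with a ≟ b
... | yes _ = dist x y
... | no  _ = suc (dist x y)

Adj : ∀ {n q} → V n q → V n q → Set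
Adj x y = dist x y ≡ 1

allV : (n q : ℕ) → List (V n q)
allV zero    q = [ [] ]ₗ
allV (suc n) q = concatMap (λ a → map (a ∷_) (allV n q)) (allFin q)

N : ∀ {n q} → V n q → List (V n q)
N {n} {q} x = filter (λ y → dist x y ℕ.≟ 1) (allV n q)

sumℚ : List ℚ → ℚ
sumℚ = foldr _+_ 0ℚ

ℕ→ℚ : ℕ → ℚ
ℕ→ℚ m = + m / 1

IsEigenfunction : (n q : ℕ) → ℚ → (V n q → ℚ) → Set
IsEigenfunction n q λ' f =
  (∃ λ x → f x ≢ 0ℚ) ×
  (∀ x → λ' * f x ≡ sumℚ (map (λ y → f x - f y) (N x)))

data Walk {n q} (P : V n q → Set) : V n q → V n q → Set where
  here : ∀ {x} → P x → Walk P x x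
  step : ∀ {x y z} → P x → Adj x y → Walk P y z → Walk P x z

-- The induced subgraph on {x | P x} has exactly k connected components:
-- there are k vertices of the set, pairwise in different components,
-- such that every vertex of the set lies in the component of one of them.
NumComponents : ∀ {n q} → (V n q → Set) → ℕ → Set
NumComponents {n} {q} P k =
  Σ (Fin k → V n q) λ r →
    (∀ i → P (r i)) ×
    (∀ i j → i ≢ j → ¬ Walk P (r i) (r j)) ×
    (∀ x → P x → ∃ λ i → Walk P x (r i))

-- SND(f) = k: number of positive plus negative strong nodal domains is k.
SNDis : ∀ {n q} → (V n q → ℚ) → ℕ → Set
SNDis f k =
  Σ ℕ λ a → Σ ℕ λ b →
    (a ℕ.+ b ≡ k) ×
    NumComponents (λ x → 0ℚ < f x) a ×
    NumComponents (λ x → f x < 0ℚ) b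

-- Let g : ℤ_q → ℚ be 1 at 0, −1 at 1 and 0 elsewhere, and f x = g x₀. A vertex
-- a ∷ x has q − 1 neighbours b ∷ x with b ≠ a, on which f takes the value g b,
-- and its other neighbours a ∷ y lie in the same layer, where f is constant. So
-- the Laplacian of f at a ∷ x is Σ_b (g a − g b) = q · g a − Σ g = q · f (a ∷ x).
-- The positive and negative sets of f are the layers x₀ = 0 and x₀ = 1, copies of
-- the connected graph H(n − 1, q), so f has exactly two strong nodal domains.
module Submission where

open import Defs
open import Data.Nat using (ℕ; _≤_; zero; suc; s≤s)
open import Data.Nat.Properties using (1+n≢0)
import Data.Nat as ℕ
open import Data.Fin using (Fin; zero; suc; _≟_)
open import Data.Fin.Properties using (suc-injective)
open import Data.Vec using ([]; _∷_; head; replicate)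
open import Data.List using (List; []; _∷_; _++_; map; concat; filter; length; tabulate; allFin)
open import Data.List using () renaming ([_] to [_]ₗ)
open import Data.List.Properties
  using (++-identityʳ; filter-++; filter-none; filter-≐; map-++; map-tabulate; tabulate-cong; length-tabulate)
open import Data.List.Relation.Unary.All using (All; []; _∷_; universal)
open import Data.List.Relation.Unary.All.Properties using (map⁺; tabulate⁺)
import Data.Integer as ℤ
import Data.Integer.Properties as ℤ
open import Data.Rational using (ℚ; 0ℚ; 1ℚ; -_; _+_; _-_; _*_; _<_; _/_)
open import Data.Rational.Properties
  using (normalize-coprime; +-identityˡ; +-identityʳ; +-inverseʳ; +-assoc; <-irrefl; <-asym; _<?_)
open import Data.Rational.Solver using (module +-*-Solver)
import Data.Nat.Coprimality as Coprimality
open import Data.Product using (Σ; _×_; _,_)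
open import Data.Unit using (tt)
open import Data.Empty using (⊥-elim)
open import Function using (_∘_)
open import Level using (0ℓ)
open import Relation.Nullary using (¬_; Dec; yes; no)
open import Relation.Nullary.Decidable using (toWitness)
open import Relation.Unary using (Pred; Decidable)
open import Relation.Binary.PropositionalEquality
open ≡-Reasoning

private
  variable
    A B : Set
    n q : ℕ

ℕ→ℚ-suc : ∀ k → ℕ→ℚ (suc k) ≡ 1ℚ + ℕ→ℚ k
ℕ→ℚ-suc k = sym (begin
  1ℚ + ℕ→ℚ k                                ≡⟨ cong (1ℚ +_) (normalize-coprime k/1-coprime) ⟩
  (ℤ.+ 1 ℤ.* ℤ.+ 1 ℤ.+ ℤ.+ k ℤ.* ℤ.+ 1) / 1  ≡⟨ cong (λ z → (ℤ.+ 1 ℤ.+ z) / 1) (ℤ.*-identityʳ (ℤ.+ k)) ⟩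
  ℕ→ℚ (suc k)                               ∎)
  where
  k/1-coprime = Coprimality.sym (Coprimality.1-coprimeTo k)

sumℚ-++ : (xs ys : List ℚ) → sumℚ (xs ++ ys) ≡ sumℚ xs + sumℚ ys
sumℚ-++ []       ys = sym (+-identityˡ _)
sumℚ-++ (x ∷ xs) ys = trans (cong (x +_) (sumℚ-++ xs ys)) (sym (+-assoc x _ _))

sumℚ-concat : (h : A → ℚ) (xss : List (List A)) →
  sumℚ (map h (concat xss)) ≡ sumℚ (map (sumℚ ∘ map h) xss)
sumℚ-concat h []         = refl
sumℚ-concat h (xs ∷ xss) = begin
  sumℚ (map h (xs ++ concat xss))               ≡⟨ cong sumℚ (map-++ h xs (concat xss)) ⟩
  sumℚ (map h xs ++ map h (concat xss))         ≡⟨ sumℚ-++ (map h xs) _ ⟩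
  sumℚ (map h xs) + sumℚ (map h (concat xss))   ≡⟨ cong (sumℚ (map h xs) +_) (sumℚ-concat h xss) ⟩
  sumℚ (map h xs) + sumℚ (map (sumℚ ∘ map h) xss) ∎

sumℚ-zero : {h : A → ℚ} {xs : List A} → All (λ x → h x ≡ 0ℚ) xs → sumℚ (map h xs) ≡ 0ℚ
sumℚ-zero []           = refl
sumℚ-zero (hx≡0 ∷ all) = cong₂ _+_ hx≡0 (sumℚ-zero all)

sumℚ-const-minus : (c : ℚ) (h : A → ℚ) (xs : List A) →
  sumℚ (map (λ x → c - h x) xs) ≡ ℕ→ℚ (length xs) * c - sumℚ (map h xs)
sumℚ-const-minus c h []       = solve 1 (λ c → con 0ℚ := con 0ℚ :* c :- con 0ℚ) refl c
  where open +-*-Solver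
sumℚ-const-minus c h (x ∷ xs) = begin
  (c - h x) + sumℚ (map (λ x → c - h x) xs)   ≡⟨ cong ((c - h x) +_) (sumℚ-const-minus c h xs) ⟩
  (c - h x) + (ℕ→ℚ k * c - s)                 ≡⟨ regroup c (h x) (ℕ→ℚ k) s ⟩
  (1ℚ + ℕ→ℚ k) * c - (h x + s)                ≡⟨ cong (λ z → z * c - (h x + s)) (sym (ℕ→ℚ-suc k)) ⟩
  ℕ→ℚ (suc k) * c - (h x + s)                 ∎
  where
  open +-*-Solver
  k = length xs
  s = sumℚ (map h xs)
  regroup : ∀ c y l t → (c - y) + (l * c - t) ≡ (1ℚ + l) * c - (y + t)
  regroup = solve 4 (λ c y l t → (c :- y) :+ (l :* c :- t) := (con 1ℚ :+ l) :* c :- (y :+ t)) refl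

filter-map : {P : Pred B 0ℓ} (P? : Decidable P) (k : A → B) (xs : List A) →
  filter P? (map k xs) ≡ map k (filter (P? ∘ k) xs)
filter-map P? k []       = refl
filter-map P? k (x ∷ xs) with P? (k x)
... | yes _ = cong (k x ∷_) (filter-map P? k xs)
... | no  _ = filter-map P? k xs

filter-concat : {P : Pred A 0ℓ} (P? : Decidable P) (xss : List (List A)) →
  filter P? (concat xss) ≡ concat (map (filter P?) xss)
filter-concat P? []         = refl
filter-concat P? (xs ∷ xss) =
  trans (filter-++ P? xs (concat xss)) (cong (filter P? xs ++_) (filter-concat P? xss))

concat-tabulate-single : (a : Fin n) (F : Fin n → List A) →
  (∀ b → b ≢ a → F b ≡ []) → concat (tabulate F) ≡ F a
concat-tabulate-single {n = suc n} zero    F off = begin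
  F zero ++ concat (tabulate (F ∘ suc))           ≡⟨ cong (F zero ++_) (cong concat tabulate-[]) ⟩
  F zero ++ concat (tabulate {n = n} (λ _ → []))  ≡⟨ cong (F zero ++_) (concat-[] n) ⟩
  F zero ++ []                                    ≡⟨ ++-identityʳ (F zero) ⟩
  F zero                                          ∎
  where
  tabulate-[] : tabulate (F ∘ suc) ≡ tabulate {n = n} (λ _ → [])
  tabulate-[] = tabulate-cong (λ b → off (suc b) λ ())
  concat-[] : ∀ k → concat (tabulate {n = k} (λ _ → [] {A = A})) ≡ []
  concat-[] zero    = refl
  concat-[] (suc k) = concat-[] k
concat-tabulate-single {n = suc n} (suc a) F off rewrite off zero (λ ()) =
  concat-tabulate-single a (F ∘ suc) (λ b b≢a → off (suc b) (b≢a ∘ suc-injective))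

dist-∷-≡ : (a : Fin q) (x y : V n q) → dist (a ∷ x) (a ∷ y) ≡ dist x y
dist-∷-≡ a x y with a ≟ a
... | yes _   = refl
... | no a≢a = ⊥-elim (a≢a refl)

dist-∷-≢ : {a b : Fin q} (x y : V n q) → a ≢ b → dist (a ∷ x) (b ∷ y) ≡ suc (dist x y)
dist-∷-≢ {a = a} {b} x y a≢b with a ≟ b
... | yes a≡b = ⊥-elim (a≢b a≡b)
... | no  _   = refl

dist-self : (x : V n q) → dist x x ≡ 0
dist-self []      = refl
dist-self (a ∷ x) = trans (dist-∷-≡ a x x) (dist-self x)

sphere : V n q → ℕ → List (V n q)
sphere {n} {q} x k = filter (λ y → dist x y ℕ.≟ k) (allV n q)

filter-allV-suc : {P : Pred (V (suc n) q) 0ℓ} (P? : Decidable P) →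
  filter P? (allV (suc n) q) ≡ concat (tabulate (λ b → map (b ∷_) (filter (P? ∘ (b ∷_)) (allV n q))))
filter-allV-suc {n} {q} P? = begin
  filter P? (concat (map layer (allFin q)))       ≡⟨ filter-concat P? (map layer (allFin q)) ⟩
  concat (map (filter P?) (map layer (allFin q))) ≡⟨ cong (concat ∘ map (filter P?)) (map-tabulate (λ b → b) layer) ⟩
  concat (map (filter P?) (tabulate layer))       ≡⟨ cong concat (map-tabulate layer (filter P?)) ⟩
  concat (tabulate (filter P? ∘ layer))           ≡⟨ cong concat (tabulate-cong (λ b → filter-map P? (b ∷_) (allV n q))) ⟩
  concat (tabulate (λ b → map (b ∷_) (filter (P? ∘ (b ∷_)) (allV n q)))) ∎
  where
  layer : Fin q → List (V (suc n) q)
  layer b = map (b ∷_) (allV n q)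

same-layer : (a : Fin q) (x : V n q) (k : ℕ) →
  filter (λ y → dist (a ∷ x) (a ∷ y) ℕ.≟ k) (allV n q) ≡ sphere x k
same-layer {n = n} a x k =
  filter-≐ _ _ ((λ {y} e → trans (sym (dist-∷-≡ a x y)) e) , (λ {y} e → trans (dist-∷-≡ a x y) e)) (allV n _)

other-layer : {a b : Fin q} (x : V n q) (k : ℕ) → a ≢ b →
  filter (λ y → dist (a ∷ x) (b ∷ y) ℕ.≟ suc k) (allV n q) ≡ sphere x k
other-layer {n = n} x k a≢b =
  filter-≐ _ _ ((λ {y} e → cong ℕ.pred (trans (sym (dist-∷-≢ x y a≢b)) e))
               , (λ {y} e → trans (dist-∷-≢ x y a≢b) (cong suc e))) (allV n _)

other-layer-empty : {a b : Fin q} (x : V n q) → a ≢ b →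
  filter (λ y → dist (a ∷ x) (b ∷ y) ℕ.≟ 0) (allV n q) ≡ []
other-layer-empty x a≢b =
  filter-none _ (universal (λ y e → 1+n≢0 (trans (sym (dist-∷-≢ x y a≢b)) e)) (allV _ _))

sphere-zero : (x : V n q) → sphere x 0 ≡ [ x ]ₗ
sphere-zero []      = refl
sphere-zero (a ∷ x) = begin
  sphere (a ∷ x) 0                                                   ≡⟨ filter-allV-suc _ ⟩
  concat (tabulate (λ b → map (b ∷_) (filter (P? b) (allV _ _))))   ≡⟨ concat-tabulate-single a _ off-diagonal ⟩
  map (a ∷_) (filter (P? a) (allV _ _))                              ≡⟨ cong (map (a ∷_)) (same-layer a x 0) ⟩
  map (a ∷_) (sphere x 0)                                            ≡⟨ cong (map (a ∷_)) (sphere-zero x) ⟩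
  [ a ∷ x ]ₗ                                                         ∎
  where
  P? = λ b y → dist (a ∷ x) (b ∷ y) ℕ.≟ 0
  off-diagonal : ∀ b → b ≢ a → map (b ∷_) (filter (P? b) (allV _ _)) ≡ []
  off-diagonal b b≢a = cong (map (b ∷_)) (other-layer-empty x (b≢a ∘ sym))

neighbourLayer : Fin q → V n q → Fin q → List (V (suc n) q)
neighbourLayer a x b with a ≟ b
... | yes _ = map (a ∷_) (N x)
... | no  _ = [ b ∷ x ]ₗ

neighbourLayer-self : (a : Fin q) (x : V n q) → neighbourLayer a x a ≡ map (a ∷_) (N x)
neighbourLayer-self a x with a ≟ a
... | yes _   = refl
... | no a≢a = ⊥-elim (a≢a refl)

neighbourLayer-other : {a b : Fin q} (x : V n q) → a ≢ b → neighbourLayer a x b ≡ [ b ∷ x ]ₗ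
neighbourLayer-other {a = a} {b} x a≢b with a ≟ b
... | yes a≡b = ⊥-elim (a≢b a≡b)
... | no  _   = refl

N-∷ : (a : Fin q) (x : V n q) → N (a ∷ x) ≡ concat (tabulate (neighbourLayer a x))
N-∷ a x = trans (filter-allV-suc _) (cong concat (tabulate-cong (λ b → layer b (a ≟ b))))
  where
  -- matching on a separate Dec argument keeps the with-abstraction out of dist
  layer : ∀ b → Dec (a ≡ b) →
    map (b ∷_) (filter (λ y → dist (a ∷ x) (b ∷ y) ℕ.≟ 1) (allV _ _)) ≡ neighbourLayer a x b
  layer b (yes refl) = trans (cong (map (a ∷_)) (same-layer a x 1)) (sym (neighbourLayer-self a x))
  layer b (no  a≢b)  = begin
    map (b ∷_) (filter (λ y → dist (a ∷ x) (b ∷ y) ℕ.≟ 1) (allV _ _)) ≡⟨ cong (map (b ∷_)) (other-layer x 0 a≢b) ⟩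
    map (b ∷_) (sphere x 0)                                              ≡⟨ cong (map (b ∷_)) (sphere-zero x) ⟩
    [ b ∷ x ]ₗ                                                           ≡⟨ sym (neighbourLayer-other x a≢b) ⟩
    neighbourLayer a x b                                                 ∎

laplacian-head : (g : Fin q → ℚ) (a : Fin q) (x : V n q) →
  sumℚ (map (λ y → g a - g (head y)) (N (a ∷ x))) ≡ sumℚ (map (λ b → g a - g b) (allFin q))
laplacian-head {q} g a x = begin
  sumℚ (map h (N (a ∷ x)))                                   ≡⟨ cong (sumℚ ∘ map h) (N-∷ a x) ⟩
  sumℚ (map h (concat (tabulate (neighbourLayer a x))))      ≡⟨ sumℚ-concat h (tabulate (neighbourLayer a x)) ⟩
  sumℚ (map (sumℚ ∘ map h) (tabulate (neighbourLayer a x)))  ≡⟨ cong sumℚ (map-tabulate (neighbourLayer a x) (sumℚ ∘ map h)) ⟩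
  sumℚ (tabulate (sumℚ ∘ map h ∘ neighbourLayer a x))        ≡⟨ cong sumℚ (tabulate-cong layer-sum) ⟩
  sumℚ (tabulate (λ b → g a - g b))                          ≡⟨ cong sumℚ (map-tabulate {n = q} (λ b → b) (λ b → g a - g b)) ⟨
  sumℚ (map (λ b → g a - g b) (allFin q))                    ∎
  where
  h = λ y → g a - g (head y)
  layer-sum : ∀ b → sumℚ (map h (neighbourLayer a x b)) ≡ g a - g b
  layer-sum b with a ≟ b
  ... | yes refl = trans (sumℚ-zero (map⁺ (universal (λ _ → +-inverseʳ (g a)) (N x)))) (sym (+-inverseʳ (g a)))
  ... | no  _    = +-identityʳ (g a - g b)

head-eigenfunction : (g : Fin q → ℚ) → sumℚ (map g (allFin q)) ≡ 0ℚ → (a : Fin q) → g a ≢ 0ℚ →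
  IsEigenfunction (suc n) q (ℕ→ℚ q) (g ∘ head)
head-eigenfunction {q} {n} g Σg≡0 a ga≢0 = (a ∷ replicate n a , ga≢0) , eigen
  where
  eigen : ∀ x → ℕ→ℚ q * g (head x) ≡ sumℚ (map (λ y → g (head x) - g (head y)) (N x))
  eigen (b ∷ x) = sym (begin
    sumℚ (map (λ y → g b - g (head y)) (N (b ∷ x)))        ≡⟨ laplacian-head g b x ⟩
    sumℚ (map (λ c → g b - g c) (allFin q))                ≡⟨ sumℚ-const-minus (g b) g (allFin q) ⟩
    ℕ→ℚ (length (allFin q)) * g b - sumℚ (map g (allFin q)) ≡⟨ cong (λ l → ℕ→ℚ l * g b - sumℚ (map g (allFin q))) (length-tabulate {n = q} (λ c → c)) ⟩
    ℕ→ℚ q * g b - sumℚ (map g (allFin q))                   ≡⟨ cong (λ s → ℕ→ℚ q * g b - s) Σg≡0 ⟩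
    ℕ→ℚ q * g b - 0ℚ                                        ≡⟨ +-identityʳ (ℕ→ℚ q * g b) ⟩
    ℕ→ℚ q * g b                                             ∎)

_++ʷ_ : {P : Pred (V n q) 0ℓ} {x y z : V n q} → Walk P x y → Walk P y z → Walk P x z
here _         ++ʷ w′ = w′
step Px x~y w  ++ʷ w′ = step Px x~y (w ++ʷ w′)

walk-∷ : {P : Pred (V (suc n) q) 0ℓ} (a : Fin q) {x z : V n q} →
  Walk (P ∘ (a ∷_)) x z → Walk P (a ∷ x) (a ∷ z)
walk-∷ a (here Px)               = here Px
walk-∷ a (step {x} {y} Px x~y w) = step Px (trans (dist-∷-≡ a x y) x~y) (walk-∷ a w)

connected : {P : Pred (V n q) 0ℓ} → (∀ x → P x) → (x z : V n q) → Walk P x z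
connected P-all []      []      = here (P-all [])
connected P-all (b ∷ x) (c ∷ z) = first-coordinate (b ≟ c) ++ʷ walk-∷ c (connected (P-all ∘ (c ∷_)) x z)
  where
  first-coordinate : Dec (b ≡ c) → Walk _ (b ∷ x) (c ∷ x)
  first-coordinate (yes refl) = here (P-all _)
  first-coordinate (no  b≢c)  =
    step (P-all _) (trans (dist-∷-≢ x x b≢c) (cong suc (dist-self x))) (here (P-all _))

single-component : {P : Pred (V n q) 0ℓ} (r : V n q) → P r → (∀ x → P x → Walk P x r) → NumComponents P 1
single-component {P = P} r Pr reach = (λ _ → r) , (λ _ → Pr) , distinct , (λ x Px → zero , reach x Px)
  where
  distinct : (i j : Fin 1) → i ≢ j → ¬ Walk P r r
  distinct zero zero 0≢0 = ⊥-elim (0≢0 refl)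

level-set-component : (g : Fin q → ℚ) (S : Pred ℚ 0ℓ) (a : Fin q) → S (g a) → (∀ b → S (g b) → b ≡ a) →
  NumComponents (λ (x : V (suc n) q) → S (g (head x))) 1
level-set-component {n = n} g S a Sga unique = single-component (a ∷ replicate n a) Sga reach
  where
  reach : ∀ x → S (g (head x)) → Walk (λ x → S (g (head x))) x (a ∷ replicate n a)
  reach (b ∷ x) Sgb with unique b Sgb
  ... | refl = walk-∷ a (connected (λ _ → Sga) x (replicate n a))

dipole : Fin (suc (suc q)) → ℚ
dipole zero          = 1ℚ
dipole (suc zero)    = - 1ℚ
dipole (suc (suc _)) = 0ℚ

dipole-sum : sumℚ (map dipole (allFin (suc (suc q)))) ≡ 0ℚ
dipole-sum {q} = cong (λ s → 1ℚ + (- 1ℚ + s))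
  (sumℚ-zero {xs = tabulate {n = q} (λ (i : Fin q) → suc (suc i))} (tabulate⁺ (λ _ → refl)))

0<1 : 0ℚ < 1ℚ
0<1 = toWitness {a? = 0ℚ <? 1ℚ} tt

-1<0 : - 1ℚ < 0ℚ
-1<0 = toWitness {a? = - 1ℚ <? 0ℚ} tt

dipole-positive : (a : Fin (suc (suc q))) → 0ℚ < dipole a → a ≡ zero
dipole-positive zero          _   = refl
dipole-positive (suc zero)    0<d = ⊥-elim (<-asym 0<d -1<0)
dipole-positive (suc (suc _)) 0<d = ⊥-elim (<-irrefl refl 0<d)

dipole-negative : (a : Fin (suc (suc q))) → dipole a < 0ℚ → a ≡ suc zero
dipole-negative zero          d<0 = ⊥-elim (<-asym d<0 0<1)
dipole-negative (suc zero)    _   = refl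
dipole-negative (suc (suc _)) d<0 = ⊥-elim (<-irrefl refl d<0)

lemma3 : (n q : ℕ) → 1 ≤ n → 2 ≤ q →
    Σ (V n q → ℚ) λ f → IsEigenfunction n q (ℕ→ℚ q) f × SNDis f 2
lemma3 zero    q             () _
lemma3 (suc n) zero          _  ()
lemma3 (suc n) (suc zero)    _  (s≤s ())
lemma3 (suc n) (suc (suc q)) _  _ =
  dipole ∘ head ,
  head-eigenfunction dipole (dipole-sum {q}) zero (λ ()) ,
  1 , 1 , refl ,
  level-set-component dipole (0ℚ <_) zero 0<1 dipole-positive ,
  level-set-component dipole (_< 0ℚ) (suc zero) -1<0 dipole-negative
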